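{- Let $G$ be a finite simple graph with vertex set $\{v_1,\dots,v_n\}$ and let $Q=\{\{v_1\},\dots,\{v_n\}\}$ be the singleton partition. Then the subgraph of $\mathcal{B}_n(G)$ induced by the neighborhood $N(Q)$ of $Q$ is isomorphic to the line graph $L(\overline{G})$ of the complement of $G$.
   Context: A stable $k$-partition of $G$ is a multiset of $k$ independent sets of $G$ (some possibly empty) partitioning $V(G)$. For $v\in V(G)$, $P-v$ is obtained from $P$ by deleting $v$ from its part. The Bell $k$-coloring graph $\mathcal{B}_k(G)$ has vertex set the stable $k$-partitions of $G$, with distinct $P,Q$ adjacent iff $P-v=Q-v$ for some $v\in V(G)$. $N(Q)$ denotes the set of neighbors of $Q$ in $\mathcal{B}_n(G)$ (not including $Q$). -}

module Defs where

open import Level using (0ℓ)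
open import Data.Nat using (ℕ)
open import Data.Fin using (Fin; _<_)
open import Data.Fin.Permutation using (Permutation′; _⟨$⟩ʳ_; _⟨$⟩ˡ_; id; flip; _∘ₚ_; inverseˡ)
open import Data.Product using (Σ; ∃; _×_; _,_; proj₁; proj₂)
open import Data.Sum using (_⊎_)
open import Data.Empty using (⊥)
open import Relation.Binary.PropositionalEquality using (_≡_; _≢_; refl; sym; trans; cong)
open import Relation.Nullary using (¬_)
open import Relation.Binary.Structures using (IsEquivalence)
open import Function.Bundles using (_⇔_)

record SimpleGraph (n : ℕ) : Set₁ where
  field
    Adj    : Fin n → Fin n → Set
    Adj-sym    : ∀ {u w} → Adj u w → Adj w u
    Adj-irrefl : ∀ {u} → ¬ Adj u u
open SimpleGraph public

-- A graph whose vertex type carries a setoid equality (needed because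
-- stable partitions are only defined up to reordering of their parts).
record SGraph : Set₁ where
  field
    V     : Set
    _≈_   : V → V → Set
    isEq  : IsEquivalence _≈_
    E     : V → V → Set

record _≅_ (A B : SGraph) : Set where
  private
    module A = SGraph A
    module B = SGraph B
  field
    to       : A.V → B.V
    from     : B.V → A.V
    to-cong  : ∀ {x y} → x A.≈ y → to x B.≈ to y
    from-cong : ∀ {x y} → x B.≈ y → from x A.≈ from y
    to-from  : ∀ y → to (from y) B.≈ y
    from-to  : ∀ x → from (to x) A.≈ x
    adj      : ∀ x y → A.E x y ⇔ B.E (to x) (to y)

-- A stable k-partition of G, encoded by the map sending each vertex to the
-- index (in Fin k) of its part; the k parts are the preimages (possibly
-- empty).
record StablePartition {n : ℕ} (G : SimpleGraph n) (k : ℕ) : Set where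
  constructor stable
  field
    part   : Fin n → Fin k
    proper : ∀ {u w} → Adj G u w → part u ≢ part w
open StablePartition public

module _ {n : ℕ} {G : SimpleGraph n} {k : ℕ} where

  -- Equality of multisets of parts: the families of parts agree after a
  -- reindexing σ of the k part labels.
  _≋_ : StablePartition G k → StablePartition G k → Set
  P ≋ Q = Σ (Permutation′ k) λ σ → ∀ u → part Q u ≡ σ ⟨$⟩ʳ part P u

  ≋-isEquivalence : IsEquivalence _≋_
  ≋-isEquivalence = record
    { refl  = λ {P} → id , λ u → refl
    ; sym   = λ {P} {Q} → λ { (σ , e) → flip σ , λ u →
                 trans (sym (inverseˡ σ)) (cong (flip σ ⟨$⟩ʳ_) (sym (e u))) }
    ; trans = λ {P} {Q} {R} → λ { (σ , e) (τ , f) → (σ ∘ₚ τ) , λ u →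
                 trans (f u) (cong (τ ⟨$⟩ʳ_) (e u)) }
    }

  SameAfterDeleting : Fin n → StablePartition G k → StablePartition G k → Set
  SameAfterDeleting v P Q =
    Σ (Permutation′ k) λ σ → ∀ u → u ≢ v → part Q u ≡ σ ⟨$⟩ʳ part P u

  BellAdj : StablePartition G k → StablePartition G k → Set
  BellAdj P Q = ¬ (P ≋ Q) × ∃ λ v → SameAfterDeleting v P Q

singletonPartition : {n : ℕ} (G : SimpleGraph n) → StablePartition G n
singletonPartition G = stable (λ u → u) (λ a eq → irreflHelper a eq)
  where
    irreflHelper : ∀ {u w} → Adj G u w → u ≡ w → ⊥
    irreflHelper a refl = Adj-irrefl G a

Bell : {n : ℕ} (G : SimpleGraph n) (k : ℕ) → SGraph
Bell G k = record
  { V = StablePartition G k ; _≈_ = _≋_ ; isEq = ≋-isEquivalence ; E = BellAdj }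

NeighbourhoodSubgraph : {n : ℕ} (G : SimpleGraph n) (k : ℕ)
  → StablePartition G k → SGraph
NeighbourhoodSubgraph {n} G k Q = record
  { V    = Σ (StablePartition G k) (λ P → BellAdj Q P)
  ; _≈_  = λ P P' → proj₁ P ≋ proj₁ P'
  ; isEq = record
      { refl  = λ {P} → IsEquivalence.refl ≋-eq {proj₁ P}
      ; sym   = λ {P} {P'} → IsEquivalence.sym ≋-eq {proj₁ P} {proj₁ P'}
      ; trans = λ {P} {P'} {P''} →
                  IsEquivalence.trans ≋-eq {proj₁ P} {proj₁ P'} {proj₁ P''} }
  ; E    = λ P P' → BellAdj (proj₁ P) (proj₁ P')
  }
  where
    ≋-eq = ≋-isEquivalence {n} {G} {k}

-- An edge of the complement is an
-- unordered pair {u,w}, u ≠ w, with u,w non-adjacent in G; it is represented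
-- canonically by its endpoints ordered as u < w.
module _ {n : ℕ} (G : SimpleGraph n) where

  CoEdge : Set
  CoEdge = Σ (Fin n × Fin n) λ p → (proj₁ p < proj₂ p) × ¬ Adj G (proj₁ p) (proj₂ p)

  _≈E_ : CoEdge → CoEdge → Set
  e ≈E f = proj₁ e ≡ proj₁ f

  ShareEndpoint : CoEdge → CoEdge → Set
  ShareEndpoint ((a , b) , _) ((c , d) , _) = (a ≡ c ⊎ a ≡ d) ⊎ (b ≡ c ⊎ b ≡ d)

  LineGraphComplement : SGraph
  LineGraphComplement = record
    { V    = CoEdge
    ; _≈_  = _≈E_
    ; isEq = record { refl = refl ; sym = sym ; trans = trans }
    ; E    = λ e f → ¬ (e ≈E f) × ShareEndpoint e f
    }

{-# OPTIONS --safe #-}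
module Submission where

-- A neighbour P of the singleton partition agrees with a relabelling σ of it
-- away from some vertex v.  If w is the vertex whose σ-label is the label of v
-- in P, then P is a relabelling of `merge v w`, the partition whose only
-- non-singleton part is {v, w}; w ≠ v as P is not the singleton partition, and
-- {v, w} is a non-edge because P is stable.  Collisions (distinct vertices in a
-- common part) survive relabelling and the only one of `merge a b` is {a, b},
-- so P determines the non-edge.  `merge a b` and `merge c d` agree after
-- deleting z exactly when z lies in both pairs: were z outside {a, b}, the
-- collision {a, b} would survive in `merge c d`.

open import Defs
open import Data.Nat using (ℕ)
open import Data.Fin using (Fin; _≟_)
open import Data.Fin.Properties using (<-cmp; <-asym; <⇒≢)
open import Data.Fin.Permutation
  using (Permutation′; _⟨$⟩ʳ_; _⟨$⟩ˡ_; id; flip; _∘ₚ_; inverseˡ; inverseʳ; transpose)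
import Data.Fin.Permutation.Components as PC
open import Data.Product using (Σ; ∃; _×_; _,_; proj₁; proj₂)
open import Data.Sum using (_⊎_; inj₁; inj₂; map)
open import Data.Empty using (⊥-elim)
open import Function.Bundles using (_⇔_; mk⇔)
open import Relation.Binary.Definitions using (tri<; tri≈; tri>)
open import Relation.Binary.PropositionalEquality
  using (_≡_; _≢_; refl; sym; trans; cong; subst)
open import Relation.Binary.Structures using (IsEquivalence)
open import Relation.Binary.Bundles using (Setoid)
import Relation.Binary.Reasoning.Setoid as SetoidReasoning
open import Level using (0ℓ)
open import Function.Construct.Composition using (_⇔-∘_)
open import Relation.Nullary using (¬_; Dec; yes; no)
open import Relation.Nullary.Decidable using (_⊎-dec_)

module _ {n k : ℕ} {G : SimpleGraph n} where

  open IsEquivalence (≋-isEquivalence {n} {G} {k})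
    using () renaming (sym to ≋-sym)

  ≋-setoid : Setoid 0ℓ 0ℓ
  ≋-setoid = record { isEquivalence = ≋-isEquivalence {n} {G} {k} }

  module ≋-Reasoning = SetoidReasoning ≋-setoid

  ≋⇒sameAfterDeleting : ∀ {v} {P Q : StablePartition G k} →
    P ≋ Q → SameAfterDeleting v P Q
  ≋⇒sameAfterDeleting (σ , eq) = σ , λ u _ → eq u

  sameAfterDeleting-sym : ∀ {v} {P Q : StablePartition G k} →
    SameAfterDeleting v P Q → SameAfterDeleting v Q P
  sameAfterDeleting-sym (σ , eq) = flip σ , λ u u≢v →
    trans (sym (inverseˡ σ)) (cong (flip σ ⟨$⟩ʳ_) (sym (eq u u≢v)))

  sameAfterDeleting-trans : ∀ {v} {P Q R : StablePartition G k} →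
    SameAfterDeleting v P Q → SameAfterDeleting v Q R → SameAfterDeleting v P R
  sameAfterDeleting-trans (σ , eq) (τ , eq′) = σ ∘ₚ τ , λ u u≢v →
    trans (eq′ u u≢v) (cong (τ ⟨$⟩ʳ_) (eq u u≢v))

  bellAdj-resp-≋ : ∀ {P P′ Q Q′ : StablePartition G k} →
    P ≋ P′ → Q ≋ Q′ → BellAdj P Q → BellAdj P′ Q′
  bellAdj-resp-≋ {P} {P′} {Q} {Q′} P≋P′ Q≋Q′ (P≉Q , v , P~Q) = P′≉Q′ , v , P′~Q′
    where
      open ≋-Reasoning

      P′≉Q′ : ¬ P′ ≋ Q′
      P′≉Q′ P′≋Q′ = P≉Q (begin P ≈⟨ P≋P′ ⟩ P′ ≈⟨ P′≋Q′ ⟩ Q′ ≈⟨ Q≋Q′ ⟨ Q ∎)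

      P′~Q′ : SameAfterDeleting v P′ Q′
      P′~Q′ = sameAfterDeleting-trans {v} {P′} {P} {Q′}
        (≋⇒sameAfterDeleting {v} {P′} {P} (≋-sym {P} {P′} P≋P′))
        (sameAfterDeleting-trans {v} {P} {Q} {Q′} P~Q (≋⇒sameAfterDeleting {v} {Q} {Q′} Q≋Q′))

  ≋-collision : ∀ {P Q : StablePartition G k} {a b} →
    P ≋ Q → part P a ≡ part P b → part Q a ≡ part Q b
  ≋-collision {a = a} {b} (σ , eq) Pa≡Pb =
    trans (eq a) (trans (cong (σ ⟨$⟩ʳ_) Pa≡Pb) (sym (eq b)))

  sameAfterDeleting-collision : ∀ {v} {P Q : StablePartition G k} {a b} →
    SameAfterDeleting v P Q → a ≢ v → b ≢ v →
    part P a ≡ part P b → part Q a ≡ part Q b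
  sameAfterDeleting-collision {a = a} {b} (σ , eq) a≢v b≢v Pa≡Pb =
    trans (eq a a≢v) (trans (cong (σ ⟨$⟩ʳ_) Pa≡Pb) (sym (eq b b≢v)))

module _ {n : ℕ} where

  transpose-right : ∀ (i j : Fin n) → PC.transpose i j j ≡ i
  transpose-right i j with j ≟ i
  ... | yes j≡i = j≡i
  ... | no _ with j ≟ j
  ...   | yes _   = refl
  ...   | no j≢j = ⊥-elim (j≢j refl)

  transpose-off : ∀ {i j u : Fin n} → u ≢ i → u ≢ j → PC.transpose i j u ≡ u
  transpose-off {i} {j} {u} u≢i u≢j with u ≟ i
  ... | yes u≡i = ⊥-elim (u≢i u≡i)
  ... | no _ with u ≟ j
  ...   | yes u≡j = ⊥-elim (u≢j u≡j)
  ...   | no _    = refl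

  merge : Fin n → Fin n → Fin n → Fin n
  merge a b u with u ≟ a
  ... | yes _ = b
  ... | no _  = u

  merge-at : ∀ a b → merge a b a ≡ b
  merge-at a b with a ≟ a
  ... | yes _   = refl
  ... | no a≢a = ⊥-elim (a≢a refl)

  merge-off : ∀ {a b u} → u ≢ a → merge a b u ≡ u
  merge-off {a} {b} {u} u≢a with u ≟ a
  ... | yes u≡a = ⊥-elim (u≢a u≡a)
  ... | no _    = refl

  merge-target : ∀ a b → merge a b b ≡ b
  merge-target a b with b ≟ a
  ... | yes _ = refl
  ... | no _  = refl

  merge-self : ∀ {a b} → b ≡ a → ∀ u → merge a b u ≡ u
  merge-self {a} refl u with u ≟ a
  ... | yes u≡a = sym u≡a
  ... | no _    = refl

  merge-collides : ∀ a b → merge a b a ≡ merge a b b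
  merge-collides a b = trans (merge-at a b) (sym (merge-target a b))

  merge-collision : ∀ {a b c d} → c ≢ d → merge a b c ≡ merge a b d →
    (c ≡ a × d ≡ b) ⊎ (c ≡ b × d ≡ a)
  merge-collision {a} {b} {c} {d} c≢d eq = cases (c ≟ a) (d ≟ a)
    where
      cases : Dec (c ≡ a) → Dec (d ≡ a) → (c ≡ a × d ≡ b) ⊎ (c ≡ b × d ≡ a)
      cases (yes refl) (yes refl) = ⊥-elim (c≢d refl)
      cases (yes refl) (no d≢a)   =
        inj₁ (refl , trans (sym (merge-off d≢a)) (trans (sym eq) (merge-at a b)))
      cases (no c≢a)   (yes refl) =
        inj₂ (trans (sym (merge-off c≢a)) (trans eq (merge-at a b)) , refl)
      cases (no c≢a)   (no d≢a)   =
        ⊥-elim (c≢d (trans (sym (merge-off c≢a)) (trans eq (merge-off d≢a))))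

  merge-swap : ∀ a b u → merge b a u ≡ PC.transpose a b (merge a b u)
  merge-swap a b u = cases (u ≟ a) (u ≟ b)
    where
      cases : Dec (u ≡ a) → Dec (u ≡ b) → merge b a u ≡ PC.transpose a b (merge a b u)
      cases (yes refl) _ = trans (merge-target b a)
        (sym (trans (cong (PC.transpose a b) (merge-at a b)) (transpose-right a b)))
      cases (no u≢a) (yes refl) = trans (merge-at b a)
        (sym (trans (cong (PC.transpose a b) (merge-off u≢a)) (transpose-right a b)))
      cases (no u≢a) (no u≢b) = trans (merge-off u≢b)
        (sym (trans (cong (PC.transpose a b) (merge-off u≢a)) (transpose-off u≢a u≢b)))

  common-endpoint : ∀ {a b c d z : Fin n} → z ≡ a ⊎ z ≡ b → z ≡ c ⊎ z ≡ d →
    (a ≡ c ⊎ a ≡ d) ⊎ (b ≡ c ⊎ b ≡ d)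
  common-endpoint (inj₁ refl) z∈cd = inj₁ z∈cd
  common-endpoint (inj₂ refl) z∈cd = inj₂ z∈cd

  shared-endpoint : ∀ {a b c d : Fin n} → (a ≡ c ⊎ a ≡ d) ⊎ (b ≡ c ⊎ b ≡ d) →
    ∃ λ z → (z ≡ a ⊎ z ≡ b) × (z ≡ c ⊎ z ≡ d)
  shared-endpoint {a} (inj₁ a∈cd) = a , inj₁ refl , a∈cd
  shared-endpoint {b = b} (inj₂ b∈cd) = b , inj₂ refl , b∈cd

  agreeOff⇒merge : ∀ (σ : Permutation′ n) {v} (f : Fin n → Fin n) →
    (∀ u → u ≢ v → f u ≡ σ ⟨$⟩ʳ u) →
    ∀ u → f u ≡ σ ⟨$⟩ʳ merge v (σ ⟨$⟩ˡ f v) u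
  agreeOff⇒merge σ {v} f agree u with u ≟ v
  ... | yes refl = sym (inverseʳ σ)
  ... | no u≢v   = agree u u≢v

module _ {n : ℕ} (G : SimpleGraph n) where

  open IsEquivalence (≋-isEquivalence {n} {G} {n})
    using () renaming (sym to ≋-sym; trans to ≋-trans)

  Q : StablePartition G n
  Q = singletonPartition G

  merge-proper : ∀ {a b} → ¬ Adj G a b →
    ∀ {u w} → Adj G u w → merge a b u ≢ merge a b w
  merge-proper {a} {b} a≁b {u} {w} u~w = cases (u ≟ a) (w ≟ a)
    where
      cases : Dec (u ≡ a) → Dec (w ≡ a) → merge a b u ≢ merge a b w
      cases (yes refl) (yes refl) _ = Adj-irrefl G u~w
      cases (yes refl) (no w≢a) eq =
        a≁b (subst (Adj G a) (trans (sym (merge-off w≢a)) (trans (sym eq) (merge-at a b))) u~w)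
      cases (no u≢a) (yes refl) eq =
        a≁b (subst (Adj G a) (trans (sym (merge-off u≢a)) (trans eq (merge-at a b)))
               (Adj-sym G u~w))
      cases (no u≢a) (no w≢a) eq =
        Adj-irrefl G
          (subst (Adj G u) (trans (sym (merge-off w≢a)) (trans (sym eq) (merge-off u≢a))) u~w)

  merged : ∀ a b → ¬ Adj G a b → StablePartition G n
  merged a b a≁b = stable (merge a b) (merge-proper a≁b)

  fromCoEdge : CoEdge G → StablePartition G n
  fromCoEdge ((a , b) , _ , a≁b) = merged a b a≁b

  merged-swap : ∀ {a b} (a≁b : ¬ Adj G a b) (b≁a : ¬ Adj G b a) →
    merged a b a≁b ≋ merged b a b≁a
  merged-swap {a} {b} _ _ = transpose a b , merge-swap a b

  merged-oriented : ∀ {a b} → a ≢ b → (a≁b : ¬ Adj G a b) →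
    Σ (CoEdge G) λ e → fromCoEdge e ≋ merged a b a≁b
  merged-oriented {a} {b} a≢b a≁b with <-cmp a b
  ... | tri< a<b _ _ = ((a , b) , a<b , a≁b) , id , λ _ → refl
  ... | tri≈ _ a≡b _ = ⊥-elim (a≢b a≡b)
  ... | tri> _ _ b<a = ((b , a) , b<a , b≁a) , merged-swap b≁a a≁b
    where
      b≁a : ¬ Adj G b a
      b≁a b~a = a≁b (Adj-sym G b~a)

  fromCoEdge-cong : ∀ {e f} → proj₁ e ≡ proj₁ f → fromCoEdge e ≋ fromCoEdge f
  fromCoEdge-cong {(a , b) , _} {(.a , .b) , _} refl = id , λ _ → refl

  fromCoEdge-injective : ∀ {e f} → fromCoEdge e ≋ fromCoEdge f → proj₁ e ≡ proj₁ f
  fromCoEdge-injective {e@((a , b) , a<b , _)} {f@((c , d) , c<d , _)} e≋f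
    with merge-collision {a = c} {b = d} (<⇒≢ a<b)
           (≋-collision {P = fromCoEdge e} {fromCoEdge f} {a} {b} e≋f (merge-collides a b))
  ... | inj₁ (refl , refl) = refl
  ... | inj₂ (refl , refl) = ⊥-elim (<-asym a<b c<d)

  singleton-sameAfterDeleting-merged : ∀ {a b z} (a≁b : ¬ Adj G a b) →
    z ≡ a ⊎ z ≡ b → SameAfterDeleting z Q (merged a b a≁b)
  singleton-sameAfterDeleting-merged a≁b (inj₁ refl) = id , λ _ → merge-off
  singleton-sameAfterDeleting-merged {a} {b} {z} a≁b (inj₂ refl) =
    sameAfterDeleting-trans {P = Q} {merged b a b≁a} {merged a b a≁b}
      (singleton-sameAfterDeleting-merged b≁a (inj₁ refl))
      (≋⇒sameAfterDeleting {P = merged b a b≁a} {merged a b a≁b} (merged-swap b≁a a≁b))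
    where
      b≁a : ¬ Adj G b a
      b≁a b~a = a≁b (Adj-sym G b~a)

  singleton-bellAdj-fromCoEdge : ∀ e → BellAdj Q (fromCoEdge e)
  singleton-bellAdj-fromCoEdge e@((a , b) , a<b , a≁b) =
    (λ Q≋e → <⇒≢ a<b (≋-collision {P = fromCoEdge e} {Q} {a} {b}
                        (≋-sym {Q} {fromCoEdge e} Q≋e) (merge-collides a b))) ,
    a , singleton-sameAfterDeleting-merged a≁b (inj₁ refl)

  bellAdj-singleton⇒fromCoEdge : ∀ {P} → BellAdj Q P → Σ (CoEdge G) λ e → fromCoEdge e ≋ P
  bellAdj-singleton⇒fromCoEdge {P} (Q≉P , v , σ , agree) = cases (w ≟ v)
    where
      w : Fin n
      w = σ ⟨$⟩ˡ part P v

      relabelled : ∀ u → part P u ≡ σ ⟨$⟩ʳ merge v w u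
      relabelled = agreeOff⇒merge σ (part P) agree

      v≁w : ¬ Adj G v w
      v≁w v~w = proper P v~w
        (trans (relabelled v) (trans (cong (σ ⟨$⟩ʳ_) (merge-collides v w)) (sym (relabelled w))))

      cases : Dec (w ≡ v) → Σ (CoEdge G) λ e → fromCoEdge e ≋ P
      cases (yes w≡v) = ⊥-elim (Q≉P (σ , λ u →
        trans (relabelled u) (cong (σ ⟨$⟩ʳ_) (merge-self w≡v u))))
      cases (no w≢v) with merged-oriented (λ v≡w → w≢v (sym v≡w)) v≁w
      ... | e , e≋vw = e , ≋-trans {fromCoEdge e} {merged v w v≁w} {P} e≋vw (σ , relabelled)

  sameAfterDeleting-avoiding⇒endpoint : ∀ {a b c d z} {a≁b : ¬ Adj G a b} {c≁d : ¬ Adj G c d} →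
    a ≢ b → SameAfterDeleting z (merged a b a≁b) (merged c d c≁d) →
    ¬ (z ≡ a ⊎ z ≡ b) → a ≡ c ⊎ a ≡ d
  sameAfterDeleting-avoiding⇒endpoint {a} {b} {c} {d} {a≁b = a≁b} {c≁d} a≢b ab~cd z∉ab =
    map proj₁ proj₁ (merge-collision a≢b
      (sameAfterDeleting-collision {P = merged a b a≁b} {merged c d c≁d} ab~cd
        (λ a≡z → z∉ab (inj₁ (sym a≡z))) (λ b≡z → z∉ab (inj₂ (sym b≡z))) (merge-collides a b)))

  sameAfterDeleting⇒shareEndpoint : ∀ {e f z} →
    SameAfterDeleting z (fromCoEdge e) (fromCoEdge f) → ShareEndpoint G e f
  sameAfterDeleting⇒shareEndpoint {e@((a , b) , a<b , a≁b)} {f@((c , d) , c<d , c≁d)} {z} e~f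
    with (z ≟ a) ⊎-dec (z ≟ b) | (z ≟ c) ⊎-dec (z ≟ d)
  ... | yes z∈ab | yes z∈cd = common-endpoint z∈ab z∈cd
  ... | no z∉ab  | _        =
    common-endpoint (inj₁ refl)
      (sameAfterDeleting-avoiding⇒endpoint {a≁b = a≁b} {c≁d} (<⇒≢ a<b) e~f z∉ab)
  ... | _        | no z∉cd  =
    common-endpoint (sameAfterDeleting-avoiding⇒endpoint {a≁b = c≁d} {a≁b} (<⇒≢ c<d) f~e z∉cd)
      (inj₁ refl)
    where
      f~e : SameAfterDeleting z (fromCoEdge f) (fromCoEdge e)
      f~e = sameAfterDeleting-sym {P = fromCoEdge e} {fromCoEdge f} e~f

  shareEndpoint⇒sameAfterDeleting : ∀ {e f} →
    ShareEndpoint G e f → ∃ λ z → SameAfterDeleting z (fromCoEdge e) (fromCoEdge f)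
  shareEndpoint⇒sameAfterDeleting {(a , b) , _ , a≁b} {(c , d) , _ , c≁d} share
    with shared-endpoint share
  ... | z , z∈ab , z∈cd = z ,
    sameAfterDeleting-trans {P = merged a b a≁b} {Q} {merged c d c≁d}
      (sameAfterDeleting-sym {P = Q} {merged a b a≁b}
        (singleton-sameAfterDeleting-merged a≁b z∈ab))
      (singleton-sameAfterDeleting-merged c≁d z∈cd)

  fromCoEdge-bellAdj⇔ : ∀ e f →
    BellAdj (fromCoEdge e) (fromCoEdge f) ⇔ (proj₁ e ≢ proj₁ f × ShareEndpoint G e f)
  fromCoEdge-bellAdj⇔ e f = mk⇔
    (λ (e≉f , z , e~f) → (λ e≈f → e≉f (fromCoEdge-cong {e} {f} e≈f)) ,
                          sameAfterDeleting⇒shareEndpoint {e} {f} {z} e~f)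
    (λ (e≉f , share) → (λ e≋f → e≉f (fromCoEdge-injective {e} {f} e≋f)) ,
                        shareEndpoint⇒sameAfterDeleting {e} {f} share)

  toCoEdge : Σ (StablePartition G n) (BellAdj Q) → CoEdge G
  toCoEdge (P , Q~P) = proj₁ (bellAdj-singleton⇒fromCoEdge {P} Q~P)

  fromCoEdge-toCoEdge : ∀ x → fromCoEdge (toCoEdge x) ≋ proj₁ x
  fromCoEdge-toCoEdge (P , Q~P) = proj₂ (bellAdj-singleton⇒fromCoEdge {P} Q~P)

  toCoEdge-fromCoEdge : ∀ e →
    proj₁ (toCoEdge (fromCoEdge e , singleton-bellAdj-fromCoEdge e)) ≡ proj₁ e
  toCoEdge-fromCoEdge e = fromCoEdge-injective {toCoEdge x} {e} (fromCoEdge-toCoEdge x)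
    where x = fromCoEdge e , singleton-bellAdj-fromCoEdge e

  toCoEdge-cong : ∀ {x y} → proj₁ x ≋ proj₁ y → proj₁ (toCoEdge x) ≡ proj₁ (toCoEdge y)
  toCoEdge-cong {x} {y} x≋y = fromCoEdge-injective {toCoEdge x} {toCoEdge y} (begin
    fromCoEdge (toCoEdge x) ≈⟨ fromCoEdge-toCoEdge x ⟩
    proj₁ x                 ≈⟨ x≋y ⟩
    proj₁ y                 ≈⟨ fromCoEdge-toCoEdge y ⟨
    fromCoEdge (toCoEdge y) ∎)
    where open ≋-Reasoning {k = n} {G = G}

  toCoEdge-bellAdj⇔ : ∀ x y → BellAdj (proj₁ x) (proj₁ y) ⇔
    (proj₁ (toCoEdge x) ≢ proj₁ (toCoEdge y) × ShareEndpoint G (toCoEdge x) (toCoEdge y))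
  toCoEdge-bellAdj⇔ x@(P , _) y@(R , _) = fromCoEdge-bellAdj⇔ (toCoEdge x) (toCoEdge y) ⇔-∘ mk⇔
    (bellAdj-resp-≋ {P = P} {P̂} {R} {R̂}
      (≋-sym {P̂} {P} (fromCoEdge-toCoEdge x)) (≋-sym {R̂} {R} (fromCoEdge-toCoEdge y)))
    (bellAdj-resp-≋ {P = P̂} {P} {R̂} {R} (fromCoEdge-toCoEdge x) (fromCoEdge-toCoEdge y))
    where
      P̂ R̂ : StablePartition G n
      P̂ = fromCoEdge (toCoEdge x)
      R̂ = fromCoEdge (toCoEdge y)

proposition6p5 : (n : ℕ) (G : SimpleGraph n) →
    NeighbourhoodSubgraph G n (singletonPartition G) ≅ LineGraphComplement G
proposition6p5 n G = record
  { to        = toCoEdge G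
  ; from      = λ e → fromCoEdge G e , singleton-bellAdj-fromCoEdge G e
  ; to-cong   = λ {x} {y} → toCoEdge-cong G {x} {y}
  ; from-cong = λ {e} {f} → fromCoEdge-cong G {e} {f}
  ; to-from   = toCoEdge-fromCoEdge G
  ; from-to   = fromCoEdge-toCoEdge G
  ; adj       = toCoEdge-bellAdj⇔ G
  }
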